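{- For every positive integer $k$, $\lambda(k)\ge\lfloor k^2/4\rfloor$.
   Context: A collection $\mathcal{L}$ of lists of strictly increasing integers is a $k$-covering family if for all integers $i,j$ with $1\le i<j\le k$, the integers $i$ and $j$ appear as consecutive members of some list in $\mathcal{L}$. $\lambda(k)$ denotes the minimum possible number of lists in a $k$-covering family. -}

module Defs where

open import Data.Nat using (ℕ)
open import Data.Integer using (ℤ; _<_; _≤_; +_)
open import Data.List using (List; []; _∷_)
open import Data.List.Relation.Unary.All using (All)
open import Data.List.Relation.Unary.Any using (Any)
open import Data.List.Relation.Unary.Linked using (Linked)
open import Data.Product using (_×_)

StrictlyIncreasing : List ℤ → Set
StrictlyIncreasing = Linked _<_

data ConsecutiveIn (x y : ℤ) : List ℤ → Set where
  here  : ∀ {zs} → ConsecutiveIn x y (x ∷ y ∷ zs)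
  there : ∀ {z zs} → ConsecutiveIn x y zs → ConsecutiveIn x y (z ∷ zs)

IsCoveringFamily : ℕ → List (List ℤ) → Set
IsCoveringFamily k 𝓛 =
  All StrictlyIncreasing 𝓛 ×
  (∀ (i j : ℤ) → + 1 ≤ i → i < j → j ≤ + k →
     Any (ConsecutiveIn i j) 𝓛)

-- Split k = a + b with a = ⌊k/2⌋ and b = ⌈k/2⌉. Each of the a·b pairs (i, j) with
-- i ≤ a < j must be consecutive in some list, and a strictly increasing list has at most
-- one pair of consecutive members straddling a. Hence distinct pairs need distinct lists,
-- so λ(k) ≥ ⌊k/2⌋·⌈k/2⌉ = ⌊k²/4⌋.
module Submission where

open import Defs
open import Data.Nat using (ℕ; _≤_; _*_; _/_; NonZero)
open import Data.List using (List; length)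
open import Data.Integer using (ℤ)

open import Data.Nat as ℕ using (zero; suc; _+_; _<_; z≤n; s≤s; ⌊_/2⌋; ⌈_/2⌉)
import Data.Nat.Properties as ℕ
open import Data.Nat.DivMod using (m<n*o⇒m/o<n)
open import Data.Nat.Tactic.RingSolver using (solve-∀)
import Data.Integer as ℤ
open import Data.Integer using (+_; +≤+; +<+)
import Data.Integer.Properties as ℤ
open import Data.List using (_∷_)
open import Data.List.Relation.Unary.All using (All; _∷_)
open import Data.List.Relation.Unary.Any using (Any; here; there; index)
open import Data.List.Relation.Unary.Linked using (_∷_)
open import Data.Product using (_×_; _,_; uncurry)
open import Data.Empty using (⊥-elim)
open import Data.Fin using (Fin; toℕ; combine; remQuot)
import Data.Fin.Properties as Fin
open import Function.Definitions using (Injective)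
open import Relation.Binary.PropositionalEquality
  using (_≡_; refl; sym; trans; cong; cong₂; subst)

Straddles : ℤ → ℤ → ℤ → Set
Straddles a i j = i ℤ.≤ a × a ℤ.< j

head≤consecutive : ∀ {x xs u v} → StrictlyIncreasing (x ∷ xs) →
                   ConsecutiveIn u v (x ∷ xs) → x ℤ.≤ u
head≤consecutive _          here      = ℤ.≤-refl
head≤consecutive (x<y ∷ xs) (there p) = ℤ.<⇒≤ (ℤ.<-≤-trans x<y (head≤consecutive xs p))

-- Later consecutive pairs start at or after j, so they cannot straddle a point below j.
straddling-consecutive-unique :
  ∀ {a xs i j i′ j′} → StrictlyIncreasing xs →
  ConsecutiveIn i j xs → ConsecutiveIn i′ j′ xs →
  Straddles a i j → Straddles a i′ j′ → i ≡ i′ × j ≡ j′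
straddling-consecutive-unique _ here here _ _ = refl , refl
straddling-consecutive-unique (_ ∷ xs) here (there q) (_ , a<j) (i′≤a , _) =
  ⊥-elim (ℤ.<-irrefl refl (ℤ.<-≤-trans (ℤ.≤-<-trans i′≤a a<j) (head≤consecutive xs q)))
straddling-consecutive-unique (_ ∷ xs) (there p) here (i≤a , _) (_ , a<j′) =
  ⊥-elim (ℤ.<-irrefl refl (ℤ.<-≤-trans (ℤ.≤-<-trans i≤a a<j′) (head≤consecutive xs p)))
straddling-consecutive-unique (_ ∷ xs) (there p) (there q) s s′ =
  straddling-consecutive-unique xs p q s s′

straddling-index-injective :
  ∀ {a 𝓛 i j i′ j′} → All StrictlyIncreasing 𝓛 →
  (p : Any (ConsecutiveIn i j) 𝓛) (q : Any (ConsecutiveIn i′ j′) 𝓛) →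
  index p ≡ index q → Straddles a i j → Straddles a i′ j′ → i ≡ i′ × j ≡ j′
straddling-index-injective (xs ∷ _) (here p)  (here q)  _  = straddling-consecutive-unique xs p q
straddling-index-injective (_ ∷ 𝓛) (there p) (there q) eq =
  straddling-index-injective 𝓛 p q (Fin.suc-injective eq)

injective-on-pairs⇒*≤ : ∀ {m n p} {f : Fin m × Fin n → Fin p} → Injective _≡_ _≡_ f → m * n ≤ p
injective-on-pairs⇒*≤ {m} {n} {f = f} f-inj =
  Fin.injective⇒≤ {f = λ c → f (remQuot {m} n c)} λ {c} {c′} eq →
  trans (sym (Fin.combine-remQuot {m} n c))
        (trans (cong (uncurry combine) (f-inj eq)) (Fin.combine-remQuot {m} n c′))

module _ (a b : ℕ) where

  low : Fin a → ℤ
  low x = + suc (toℕ x)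

  high : Fin b → ℤ
  high y = + (a + suc (toℕ y))

  low-injective : Injective _≡_ _≡_ low
  low-injective eq = Fin.toℕ-injective (ℕ.suc-injective (ℤ.+-injective eq))

  high-injective : Injective _≡_ _≡_ high
  high-injective eq = Fin.toℕ-injective (ℕ.suc-injective (ℕ.+-cancelˡ-≡ a _ _ (ℤ.+-injective eq)))

  low-high-straddle : ∀ x y → Straddles (+ a) (low x) (high y)
  low-high-straddle x y = +≤+ (Fin.toℕ<n x) , +<+ (ℕ.m<m+n a (s≤s z≤n))

  covering⇒*≤length : ∀ 𝓛 → IsCoveringFamily (a + b) 𝓛 → a * b ≤ length 𝓛
  covering⇒*≤length 𝓛 (increasing , covers) = injective-on-pairs⇒*≤ {f = uncurry list-of} injective
    where
    covered : ∀ x y → Any (ConsecutiveIn (low x) (high y)) 𝓛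
    covered x y = covers (low x) (high y) (+≤+ (s≤s z≤n))
      (uncurry ℤ.≤-<-trans (low-high-straddle x y))
      (+≤+ (ℕ.+-monoʳ-≤ a (Fin.toℕ<n y)))

    list-of : Fin a → Fin b → Fin (length 𝓛)
    list-of x y = index (covered x y)

    injective : Injective _≡_ _≡_ (uncurry list-of)
    injective {x , y} {x′ , y′} eq
      with straddling-index-injective increasing (covered x y) (covered x′ y′) eq
             (low-high-straddle x y) (low-high-straddle x′ y′)
    ... | low≡ , high≡ = cong₂ _,_ (low-injective low≡) (high-injective high≡)

k*k<[1+⌊k/2⌋*⌈k/2⌉]*4 : ∀ k → k * k < suc (⌊ k /2⌋ * ⌈ k /2⌉) * 4
k*k<[1+⌊k/2⌋*⌈k/2⌉]*4 zero          = s≤s z≤n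
k*k<[1+⌊k/2⌋*⌈k/2⌉]*4 (suc zero)    = s≤s (s≤s z≤n)
k*k<[1+⌊k/2⌋*⌈k/2⌉]*4 (suc (suc k)) = begin-strict
  (2 + k) * (2 + k)                 ≡⟨ expand-square k ⟩
  k * k + 4 * suc k                 <⟨ ℕ.+-monoˡ-< (4 * suc k) (k*k<[1+⌊k/2⌋*⌈k/2⌉]*4 k) ⟩
  suc (f * c) * 4 + 4 * suc k       ≡⟨ cong (λ t → suc (f * c) * 4 + 4 * suc t) (sym (ℕ.⌊n/2⌋+⌈n/2⌉≡n k)) ⟩
  suc (f * c) * 4 + 4 * suc (f + c) ≡⟨ expand-product f c ⟩
  suc (suc f * suc c) * 4           ∎
  where
  open ℕ.≤-Reasoning
  f c : ℕ
  f = ⌊ k /2⌋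
  c = ⌈ k /2⌉
  expand-square : ∀ k → (2 + k) * (2 + k) ≡ k * k + 4 * suc k
  expand-square = solve-∀
  expand-product : ∀ f c → suc (f * c) * 4 + 4 * suc (f + c) ≡ suc (suc f * suc c) * 4
  expand-product = solve-∀

⌊k*k/4⌋≤⌊k/2⌋*⌈k/2⌉ : ∀ k → k * k / 4 ≤ ⌊ k /2⌋ * ⌈ k /2⌉
⌊k*k/4⌋≤⌊k/2⌋*⌈k/2⌉ k = ℕ.m<1+n⇒m≤n (m<n*o⇒m/o<n (k*k<[1+⌊k/2⌋*⌈k/2⌉]*4 k))

lemma42 : (k : ℕ) → .{{_ : NonZero k}} → (𝓛 : List (List ℤ)) →
          IsCoveringFamily k 𝓛 → (k * k) / 4 ≤ length 𝓛
lemma42 k 𝓛 covering = ℕ.≤-trans (⌊k*k/4⌋≤⌊k/2⌋*⌈k/2⌉ k)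
  (covering⇒*≤length ⌊ k /2⌋ ⌈ k /2⌉ 𝓛
    (subst (λ n → IsCoveringFamily n 𝓛) (sym (ℕ.⌊n/2⌋+⌈n/2⌉≡n k)) covering))
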